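{- Let $G=(V,E,w)$ be a connected graph with positive edge weights and $|V|=n$. Then $$\sum_{xy\in E}w(xy)\,d_\infty(x,y)\geq\frac{n}{2}.$$
   Context: $d_\infty(s,t)=\min\{\max_{e\in E}|f(e)/w(e)|: f \text{ a flow shipping one unit from } s \text{ to } t\}$, which equals $1/\mathrm{mincut}(s,t)$, where $\mathrm{mincut}(s,t)$ is the minimum total weight of edges whose removal separates $s$ from $t$.
   Formalization: The edge weights and the flow values $f(e)$ entering $d_\infty$ are rational. -}

module Defs where

open import Data.Nat as ℕ using (ℕ)
open import Data.Fin using (Fin; toℕ)
open import Data.List using (List; foldr; map; allFin)
open import Data.Integer using (+_)
open import Data.Rational using (ℚ; 0ℚ; 1ℚ; _+_; _*_; _÷_; _⊔_; ∣_∣; _≤_; _<_; -_; >-nonZero)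
open import Data.Rational.Properties using (_<?_)
open import Data.Fin using (_≟_)
open import Relation.Nullary using (yes; no; ¬_)
open import Relation.Binary.PropositionalEquality using (_≡_; _≢_)
open import Data.Product using (_×_)

Σ : ∀ {n} → (Fin n → ℚ) → ℚ
Σ {n} f = foldr _+_ 0ℚ (map f (allFin n))

Max : ∀ {n} → (Fin n → ℚ) → ℚ
Max {n} f = foldr _⊔_ 0ℚ (map f (allFin n))

-- A simple undirected graph on vertex set Fin n with positive edge weights:
-- a symmetric weight function, zero on the diagonal, nonnegative;
-- xy is an edge iff w x y > 0 (so every edge has positive weight).
record WGraph (n : ℕ) : Set where
  field
    w      : Fin n → Fin n → ℚ
    w-sym  : ∀ x y → w x y ≡ w y x
    w-loop : ∀ x → w x x ≡ 0ℚ
    w-nneg : ∀ x y → 0ℚ ≤ w x y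
open WGraph public

Edge : ∀ {n} → WGraph n → Fin n → Fin n → Set
Edge G x y = 0ℚ < w G x y

data Walk {n} (G : WGraph n) : Fin n → Fin n → Set where
  [] : ∀ {x} → Walk G x x
  _∷_ : ∀ {x y z} → Edge G x y → Walk G y z → Walk G x z

Connected : ∀ {n} → WGraph n → Set
Connected G = ∀ x y → Walk G x y

demand : ∀ {n} → Fin n → Fin n → Fin n → ℚ
demand s t v with v ≟ s | v ≟ t
... | yes _ | yes _ = 0ℚ
... | yes _ | no _  = 1ℚ
... | no _  | yes _ = - 1ℚ
... | no _  | no _  = 0ℚ

-- A flow shipping one unit from s to t: f x y is the (signed) flow on
-- edge xy in direction x → y.
record Flow {n} (G : WGraph n) (s t : Fin n) : Set where
  field
    f            : Fin n → Fin n → ℚ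
    f-antisym    : ∀ x y → f x y ≡ - f y x
    f-support    : ∀ x y → ¬ Edge G x y → f x y ≡ 0ℚ
    conservation : ∀ v → Σ (λ y → f v y) ≡ demand s t v
open Flow public

-- |f(e)/w(e)| for e = xy, only meaningful (and only used) on edges
ratio : ∀ {n} (G : WGraph n) {s t} → Flow G s t → Fin n → Fin n → ℚ
ratio G F x y with 0ℚ <? w G x y
... | yes p = (∣ f F x y ∣ ÷ w G x y) {{>-nonZero p}}
... | no _  = 0ℚ

congestion : ∀ {n} (G : WGraph n) {s t} → Flow G s t → ℚ
congestion G F = Max (λ x → Max (λ y → ratio G F x y))

-- Σ_{xy ∈ E} g(x,y), each unordered pair counted once (x < y); non-edges
-- are skipped.
ΣEdges : ∀ {n} (G : WGraph n) → (Fin n → Fin n → ℚ) → ℚ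
ΣEdges G g = Σ (λ x → Σ (λ y → pick x y))
  where
  pick : _ → _ → ℚ
  pick x y with toℕ x ℕ.<? toℕ y | 0ℚ <? w G x y
  ... | yes _ | yes _ = g x y
  ... | _     | _     = 0ℚ

-- A unit s–t flow F has net outflow 1 at s and net inflow 1 at t, carried by edges of total
-- weight deg s (resp. deg t), so its congestion is at least 1/deg s and at least 1/deg t.
-- Hence an edge xy with x < y contributes w(xy)·cong(F x y) ≥ w(xy)/deg x and ≥ w(xy)/deg y.
-- Charging w(xy)/deg x to the x-end and w(xy)/deg y to the y-end of every edge, vertex x is
-- charged Σ_y w(xy)/deg x = 1 in total, so twice the edge sum is at least n. Connectivity and
-- n ≥ 2 make every degree positive.
module Submission where

open import Defs
open import Data.Nat using (ℕ; _≤_)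
open import Data.Fin using (Fin)
open import Data.Integer using (+_)
open import Data.Rational using (ℚ; _/_; _*_) renaming (_≤_ to _≤ℚ_)

open import Algebra.Bundles using (CommutativeRing)
open import Data.Empty using (⊥-elim)
open import Data.Fin using (zero; suc; toℕ; punchIn; _≟_)
import Data.Fin.Properties as Fin
import Data.Integer as ℤ
open import Data.Integer.Tactic.RingSolver using (solve-∀)
import Data.List as List
import Data.List.Properties as List
import Data.Nat as ℕ
import Data.Nat.Properties as ℕ
open import Data.Rational
  using (0ℚ; 1ℚ; ½; _+_; _<_; ∣_∣; 1/_; _÷_; _⊔_; NonZero; >-nonZero; positive; nonNegative; toℚᵘ)
open import Data.Rational.Properties as ℚ using (_<?_; module ≤-Reasoning)
import Data.Rational.Unnormalised as ℚᵘ
import Data.Rational.Unnormalised.Properties as ℚᵘ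
open import Data.Sum using (_⊎_; inj₁; inj₂; [_,_]′)
open import Data.Vec.Functional as Vector using (Vector)
open import Function using (_∘_; id)
open import Relation.Binary using (tri<; tri≈; tri>)
open import Relation.Binary.PropositionalEquality
open import Relation.Nullary using (yes; no; ¬_; contradiction)

open import Algebra.Properties.Semiring.Sum (CommutativeRing.semiring ℚ.+-*-commutativeRing)
  using (sum; sum-cong-≗; sum-remove; ∑-distrib-+; ∑-comm; *-distribˡ-sum; *-distribʳ-sum)

foldr-tabulate : ∀ {A B : Set} (_∙_ : A → B → B) (e : B) {n} (f : Vector A n) →
  List.foldr _∙_ e (List.tabulate f) ≡ Vector.foldr _∙_ e f
foldr-tabulate _∙_ e {ℕ.zero}  f = refl
foldr-tabulate _∙_ e {ℕ.suc n} f = cong (f zero ∙_) (foldr-tabulate _∙_ e (f ∘ suc))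

foldr-map-allFin : ∀ {A B : Set} (_∙_ : A → B → B) (e : B) {n} (f : Vector A n) →
  List.foldr _∙_ e (List.map f (List.allFin n)) ≡ Vector.foldr _∙_ e f
foldr-map-allFin _∙_ e f =
  trans (cong (List.foldr _∙_ e) (List.map-tabulate id f)) (foldr-tabulate _∙_ e f)

Σ≡sum : ∀ {n} (f : Vector ℚ n) → Σ f ≡ sum f
Σ≡sum = foldr-map-allFin _+_ 0ℚ

Σ-cong : ∀ {n} {f g : Vector ℚ n} → (∀ i → f i ≡ g i) → Σ f ≡ Σ g
Σ-cong {f = f} {g} f≗g = trans (Σ≡sum f) (trans (sum-cong-≗ f≗g) (sym (Σ≡sum g)))

Max-upper : ∀ {n} (f : Vector ℚ n) i → f i ≤ℚ Max f
Max-upper f i = subst (f i ≤ℚ_) (sym (foldr-map-allFin _⊔_ 0ℚ f)) (foldr-⊔-upper f i)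
  where
  foldr-⊔-upper : ∀ {n} (f : Vector ℚ n) i → f i ≤ℚ Vector.foldr _⊔_ 0ℚ f
  foldr-⊔-upper f zero    = ℚ.p≤p⊔q (f zero) _
  foldr-⊔-upper f (suc i) = ℚ.p≤q⇒p≤r⊔q (f zero) (foldr-⊔-upper (f ∘ suc) i)

sum-mono-≤ : ∀ {n} {f g : Vector ℚ n} → (∀ i → f i ≤ℚ g i) → sum f ≤ℚ sum g
sum-mono-≤ {ℕ.zero}  f≤g = ℚ.≤-refl
sum-mono-≤ {ℕ.suc n} f≤g = ℚ.+-mono-≤ (f≤g zero) (sum-mono-≤ (f≤g ∘ suc))

sum-nonNeg : ∀ {n} {f : Vector ℚ n} → (∀ i → 0ℚ ≤ℚ f i) → 0ℚ ≤ℚ sum f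
sum-nonNeg {ℕ.zero}  0≤f = ℚ.≤-refl
sum-nonNeg {ℕ.suc n} 0≤f = ℚ.+-mono-≤ (0≤f zero) (sum-nonNeg (0≤f ∘ suc))

sum-pos : ∀ {n} {f : Vector ℚ n} → (∀ i → 0ℚ ≤ℚ f i) → ∀ j → 0ℚ < f j → 0ℚ < sum f
sum-pos {ℕ.suc n} {f} 0≤f j 0<fj = begin-strict
  0ℚ                              <⟨ ℚ.+-mono-<-≤ 0<fj (sum-nonNeg (0≤f ∘ punchIn j)) ⟩
  f j + sum (Vector.removeAt f j) ≡⟨ sum-remove f ⟨
  sum f                           ∎
  where open ≤-Reasoning

∣sum∣≤sum∣∣ : ∀ {n} (f : Vector ℚ n) → ∣ sum f ∣ ≤ℚ sum (∣_∣ ∘ f)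
∣sum∣≤sum∣∣ {ℕ.zero}  f = ℚ.≤-refl
∣sum∣≤sum∣∣ {ℕ.suc n} f = ℚ.≤-trans (ℚ.∣p+q∣≤∣p∣+∣q∣ (f zero) _)
                                    (ℚ.+-mono-≤ (ℚ.≤-refl {∣ f zero ∣}) (∣sum∣≤sum∣∣ (f ∘ suc)))

sum-replicate-½ : ∀ n → sum (Vector.replicate n ½) ≡ + n / 2
sum-replicate-½ ℕ.zero    = refl
sum-replicate-½ (ℕ.suc n) = trans (cong (_+_ ½) (sum-replicate-½ n)) (ℚ.toℚᵘ-injective (begin
  toℚᵘ (½ + + n / 2)           ≈⟨ ℚ.toℚᵘ-homo-+ ½ (+ n / 2) ⟩
  toℚᵘ ½ ℚᵘ.+ toℚᵘ (+ n / 2)   ≈⟨ ℚᵘ.+-congʳ (toℚᵘ ½) (ℚ.toℚᵘ-fromℚᵘ (ℚᵘ.mkℚᵘ (+ n) 1)) ⟩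
  toℚᵘ ½ ℚᵘ.+ ℚᵘ.mkℚᵘ (+ n) 1  ≈⟨ ℚᵘ.*≡* (cross-multiplied (+ n)) ⟩
  ℚᵘ.mkℚᵘ (+ ℕ.suc n) 1       ≈⟨ ℚ.toℚᵘ-fromℚᵘ (ℚᵘ.mkℚᵘ (+ ℕ.suc n) 1) ⟨
  toℚᵘ (+ ℕ.suc n / 2)        ∎))
  where
  open ℚᵘ.≃-Reasoning
  cross-multiplied : ∀ k → (+ 1 ℤ.* + 2 ℤ.+ k ℤ.* + 2) ℤ.* + 2 ≡ (+ 1 ℤ.+ k) ℤ.* + 4
  cross-multiplied = solve-∀

p*[q÷p]≡q : ∀ p q .{{_ : NonZero p}} → p * (q ÷ p) ≡ q
p*[q÷p]≡q p q = begin
  p * (q * 1/ p)  ≡⟨ cong (p *_) (ℚ.*-comm q (1/ p)) ⟩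
  p * (1/ p * q)  ≡⟨ ℚ.*-assoc p (1/ p) q ⟨
  p * 1/ p * q    ≡⟨ cong (_* q) (ℚ.*-inverseʳ p) ⟩
  1ℚ * q          ≡⟨ ℚ.*-identityˡ q ⟩
  q               ∎
  where open ≡-Reasoning

1≤p*q⇒1/p≤q : ∀ {p q} (0<p : 0ℚ < p) → 1ℚ ≤ℚ p * q → (1/ p) {{>-nonZero 0<p}} ≤ℚ q
1≤p*q⇒1/p≤q {p} 0<p 1≤pq = ℚ.*-cancelˡ-≤-pos p {{positive 0<p}}
  (subst (_≤ℚ p * _) (sym (ℚ.*-inverseʳ p {{>-nonZero 0<p}})) 1≤pq)

½*[p+p]≡p : ∀ p → ½ * (p + p) ≡ p
½*[p+p]≡p p = begin
  ½ * (p + p)    ≡⟨ ℚ.*-distribˡ-+ ½ p p ⟩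
  ½ * p + ½ * p  ≡⟨ ℚ.*-distribʳ-+ p ½ ½ ⟨
  (½ + ½) * p    ≡⟨ ℚ.*-identityˡ p ⟩
  p              ∎
  where open ≡-Reasoning

∣demand-endpoint∣≡1 : ∀ {n} {s t v : Fin n} → ¬ s ≡ t → v ≡ s ⊎ v ≡ t → ∣ demand s t v ∣ ≡ 1ℚ
∣demand-endpoint∣≡1 {s = s} {t} {v} s≢t v∈st with v ≟ s | v ≟ t
... | yes v≡s | yes v≡t = contradiction (trans (sym v≡s) v≡t) s≢t
... | yes _   | no _    = refl
... | no _    | yes _   = refl
... | no v≢s  | no v≢t  = ⊥-elim ([ v≢s , v≢t ]′ v∈st)

degree : ∀ {n} → WGraph n → Fin n → ℚ
degree G x = sum (w G x)

module _ {n} (G : WGraph n) where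

  ¬Edge⇒w≡0 : ∀ {x y} → ¬ Edge G x y → w G x y ≡ 0ℚ
  ¬Edge⇒w≡0 {x} {y} ¬e = ℚ.≤-antisym (ℚ.≮⇒≥ ¬e) (w-nneg G x y)

  edge⊎w≡0 : ∀ x y → Edge G x y ⊎ w G x y ≡ 0ℚ
  edge⊎w≡0 x y with 0ℚ <? w G x y
  ... | yes e = inj₁ e
  ... | no ¬e = inj₂ (¬Edge⇒w≡0 ¬e)

  walk⇒degree>0 : ∀ {x y} → ¬ x ≡ y → Walk G x y → 0ℚ < degree G x
  walk⇒degree>0     x≢y []                    = contradiction refl x≢y
  walk⇒degree>0 {x} x≢y (_∷_ {y = z} x–z _) = sum-pos (w-nneg G x) z x–z

  module _ {s t} (F : Flow G s t) where

    w*ratio≡∣f∣ : ∀ {x y} → Edge G x y → w G x y * ratio G F x y ≡ ∣ f F x y ∣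
    w*ratio≡∣f∣ {x} {y} e with 0ℚ <? w G x y
    ... | yes e′ = p*[q÷p]≡q (w G x y) ∣ f F x y ∣ {{>-nonZero e′}}
    ... | no ¬e  = contradiction e ¬e

    ratio≤congestion : ∀ x y → ratio G F x y ≤ℚ congestion G F
    ratio≤congestion x y =
      ℚ.≤-trans (Max-upper (ratio G F x) y) (Max-upper (λ x → Max (ratio G F x)) x)

    ∣f∣≤w*congestion : ∀ x y → ∣ f F x y ∣ ≤ℚ w G x y * congestion G F
    ∣f∣≤w*congestion x y with 0ℚ <? w G x y
    ... | yes e = begin
      ∣ f F x y ∣               ≡⟨ w*ratio≡∣f∣ e ⟨
      w G x y * ratio G F x y   ≤⟨ ℚ.*-monoˡ-≤-nonNeg (w G x y) {{nonNegative (w-nneg G x y)}}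
                                                      (ratio≤congestion x y) ⟩
      w G x y * congestion G F  ∎
      where open ≤-Reasoning
    ... | no ¬e rewrite f-support F x y ¬e | ¬Edge⇒w≡0 ¬e =
      ℚ.≤-reflexive (sym (ℚ.*-zeroˡ (congestion G F)))

    ∣demand∣≤degree*congestion : ∀ v → ∣ demand s t v ∣ ≤ℚ degree G v * congestion G F
    ∣demand∣≤degree*congestion v = begin
      ∣ demand s t v ∣                      ≡⟨ cong ∣_∣ (trans (sym (conservation F v)) (Σ≡sum (f F v))) ⟩
      ∣ sum (f F v) ∣                       ≤⟨ ∣sum∣≤sum∣∣ (f F v) ⟩
      sum (∣_∣ ∘ f F v)                     ≤⟨ sum-mono-≤ (∣f∣≤w*congestion v) ⟩
      sum (λ y → w G v y * congestion G F)  ≡⟨ *-distribʳ-sum (congestion G F) (w G v) ⟨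
      degree G v * congestion G F           ∎
      where open ≤-Reasoning

edgeTerm : ∀ {n} → WGraph n → (Fin n → Fin n → ℚ) → Fin n → Fin n → ℚ
edgeTerm G g x y with toℕ x ℕ.<? toℕ y | 0ℚ <? w G x y
... | yes _ | yes _ = g x y
... | _     | _     = 0ℚ

-- The summand of ΣEdges is local to its definition, so it can only be named by
-- unification: this signature is solved from its use in ΣEdges≡sum-edgeTerm.
summand≡edgeTerm : ∀ {n} (G : WGraph n) g (x y : Fin n) → _ ≡ edgeTerm G g x y

ΣEdges≡sum-edgeTerm : ∀ {n} (G : WGraph n) g → ΣEdges G g ≡ sum (λ x → sum (edgeTerm G g x))
ΣEdges≡sum-edgeTerm G g = begin
  ΣEdges G g                        ≡⟨ Σ-cong (λ x → Σ-cong (summand≡edgeTerm G g x)) ⟩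
  Σ (λ x → Σ (edgeTerm G g x))      ≡⟨ Σ-cong (λ x → Σ≡sum (edgeTerm G g x)) ⟩
  Σ (λ x → sum (edgeTerm G g x))    ≡⟨ Σ≡sum (λ x → sum (edgeTerm G g x)) ⟩
  sum (λ x → sum (edgeTerm G g x))  ∎
  where open ≡-Reasoning

summand≡edgeTerm G g x y with toℕ x ℕ.<? toℕ y | 0ℚ <? w G x y
... | yes _ | yes _ = refl
... | yes _ | no _  = refl
... | no _  | _     = refl

module _ {n} (G : WGraph n) (g : Fin n → Fin n → ℚ) {x y : Fin n} where

  edgeTerm-< : toℕ x ℕ.< toℕ y → Edge G x y → edgeTerm G g x y ≡ g x y
  edgeTerm-< x<y e with toℕ x ℕ.<? toℕ y | 0ℚ <? w G x y
  ... | yes _  | yes _ = refl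
  ... | yes _  | no ¬e = contradiction e ¬e
  ... | no x≮y | _     = contradiction x<y x≮y

  edgeTerm-≮ : ¬ toℕ x ℕ.< toℕ y → edgeTerm G g x y ≡ 0ℚ
  edgeTerm-≮ x≮y with toℕ x ℕ.<? toℕ y | 0ℚ <? w G x y
  ... | yes x<y | _ = contradiction x<y x≮y
  ... | no _    | _ = refl

  edgeTerm-w≡0 : w G x y ≡ 0ℚ → edgeTerm G g x y ≡ 0ℚ
  edgeTerm-w≡0 w≡0 with toℕ x ℕ.<? toℕ y | 0ℚ <? w G x y
  ... | yes _ | yes e = contradiction e (ℚ.<-irrefl (sym w≡0))
  ... | yes _ | no _  = refl
  ... | no _  | _     = refl

weighted-congestion : ∀ {n} (G : WGraph n) → (∀ x y → Flow G x y) → Fin n → Fin n → ℚ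
weighted-congestion G F x y = w G x y * congestion G (F x y)

module _ {n} (G : WGraph n) (degree>0 : ∀ x → 0ℚ < degree G x) (F : ∀ x y → Flow G x y) where

  degree⁻¹ : Fin n → ℚ
  degree⁻¹ x = (1/ degree G x) {{>-nonZero (degree>0 x)}}

  transition : Fin n → Fin n → ℚ
  transition x y = w G x y * degree⁻¹ x

  transition-row : ∀ x → sum (transition x) ≡ 1ℚ
  transition-row x = trans (sym (*-distribʳ-sum (degree⁻¹ x) (w G x)))
                           (ℚ.*-inverseʳ (degree G x) {{>-nonZero (degree>0 x)}})

  transition≤w*congestion : ∀ {s t v} → ¬ s ≡ t → v ≡ s ⊎ v ≡ t →
    ∀ y → transition v y ≤ℚ w G v y * congestion G (F s t)
  transition≤w*congestion {s} {t} {v} s≢t v∈st y =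
    ℚ.*-monoˡ-≤-nonNeg (w G v y) {{nonNegative (w-nneg G v y)}} (1≤p*q⇒1/p≤q (degree>0 v) 1≤d*c)
    where
    1≤d*c : 1ℚ ≤ℚ degree G v * congestion G (F s t)
    1≤d*c = subst (_≤ℚ degree G v * congestion G (F s t)) (∣demand-endpoint∣≡1 s≢t v∈st)
                  (∣demand∣≤degree*congestion G (F s t) v)

  private
    E : Fin n → Fin n → ℚ
    E = edgeTerm G (weighted-congestion G F)

  transition≤edgeTerms : ∀ x y → transition x y ≤ℚ E x y + E y x
  transition≤edgeTerms x y with edge⊎w≡0 G x y
  ... | inj₂ w≡0 = begin
    transition x y   ≡⟨ cong (_* degree⁻¹ x) w≡0 ⟩
    0ℚ * degree⁻¹ x  ≡⟨ ℚ.*-zeroˡ (degree⁻¹ x) ⟩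
    0ℚ + 0ℚ          ≡⟨ cong₂ _+_ (edgeTerm-w≡0 G _ w≡0)
                                  (edgeTerm-w≡0 G _ (trans (w-sym G y x) w≡0)) ⟨
    E x y + E y x    ∎
    where open ≤-Reasoning
  ... | inj₁ x–y with ℕ.<-cmp (toℕ x) (toℕ y)
  ...   | tri< x<y _ y≮x = begin
    transition x y                    ≤⟨ transition≤w*congestion (λ { refl → ℕ.<-irrefl refl x<y })
                                                                 (inj₁ refl) y ⟩
    weighted-congestion G F x y       ≡⟨ ℚ.+-identityʳ _ ⟨
    weighted-congestion G F x y + 0ℚ  ≡⟨ cong₂ _+_ (edgeTerm-< G _ x<y x–y) (edgeTerm-≮ G _ y≮x) ⟨
    E x y + E y x                     ∎
    where open ≤-Reasoning
  ...   | tri≈ _ x≡y _ = contradiction x–y (ℚ.<-irrefl (sym w≡0))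
    where
    w≡0 : w G x y ≡ 0ℚ
    w≡0 = trans (cong (w G x) (sym (Fin.toℕ-injective x≡y))) (w-loop G x)
  ...   | tri> x≮y _ y<x = begin
    transition x y                    ≤⟨ transition≤w*congestion (λ { refl → ℕ.<-irrefl refl y<x })
                                                                 (inj₂ refl) y ⟩
    w G x y * congestion G (F y x)    ≡⟨ cong (_* congestion G (F y x)) (w-sym G x y) ⟩
    weighted-congestion G F y x       ≡⟨ ℚ.+-identityˡ _ ⟨
    0ℚ + weighted-congestion G F y x  ≡⟨ cong₂ _+_ (edgeTerm-≮ G _ x≮y) (edgeTerm-< G _ y<x y–x) ⟨
    E x y + E y x                     ∎
    where
    open ≤-Reasoning
    y–x : Edge G y x
    y–x = subst (0ℚ <_) (w-sym G x y) x–y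

  vertices≤2ΣEdges : sum (Vector.replicate n 1ℚ) ≤ℚ
    ΣEdges G (weighted-congestion G F) + ΣEdges G (weighted-congestion G F)
  vertices≤2ΣEdges = begin
    sum (Vector.replicate n 1ℚ)                ≡⟨ sum-cong-≗ {x = sum ∘ transition} transition-row ⟨
    sum (λ x → sum (transition x))             ≤⟨ sum-mono-≤ (sum-mono-≤ ∘ transition≤edgeTerms) ⟩
    sum (λ x → sum (λ y → E x y + E y x))      ≡⟨ sum-cong-≗ (λ x → ∑-distrib-+ (E x) (λ y → E y x)) ⟩
    sum (λ x → sum (E x) + sum (λ y → E y x))  ≡⟨ ∑-distrib-+ (sum ∘ E) (λ x → sum (λ y → E y x)) ⟩
    T + sum (λ x → sum (λ y → E y x))          ≡⟨ cong (_+_ T) (∑-comm E) ⟨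
    T + T                                      ≡⟨ cong₂ _+_ S≡T S≡T ⟨
    S + S                                      ∎
    where
    open ≤-Reasoning
    S T : ℚ
    S = ΣEdges G (weighted-congestion G F)
    T = sum (sum ∘ E)
    S≡T : S ≡ T
    S≡T = ΣEdges≡sum-edgeTerm G (weighted-congestion G F)

claim2p13 : (n : ℕ) → 2 ≤ n → (G : WGraph n) → Connected G →
    (F : (x y : Fin n) → Flow G x y) →
    (+ n / 2) ≤ℚ ΣEdges G (λ x y → w G x y * congestion G (F x y))
claim2p13 n@(ℕ.suc (ℕ.suc _)) (ℕ.s≤s (ℕ.s≤s _)) G connected F = begin
  + n / 2                          ≡⟨ sum-replicate-½ n ⟨
  sum (Vector.replicate n ½)       ≡⟨ *-distribˡ-sum ½ (Vector.replicate n 1ℚ) ⟨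
  ½ * sum (Vector.replicate n 1ℚ)  ≤⟨ ℚ.*-monoˡ-≤-nonNeg ½ (vertices≤2ΣEdges G degree>0 F) ⟩
  ½ * (S + S)                      ≡⟨ ½*[p+p]≡p S ⟩
  S                                ∎
  where
  open ≤-Reasoning
  S : ℚ
  S = ΣEdges G (weighted-congestion G F)
  degree>0 : ∀ x → 0ℚ < degree G x
  degree>0 x = walk⇒degree>0 G (Fin.punchInᵢ≢i x zero ∘ sym) (connected x (punchIn x zero))
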